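{- Let $f:\mathbb{N}\to\mathbb{R}$ be defined by $f(0)=0$ and $f(n)=f(n-1)+1+\frac{1}{n}\sum_{i=0}^{n-1}f(i)$ for $n>0$. Then for every $n\ge 0$, $$f(n)=\sum_{k=1}^{n}\frac{1}{k!}\binom{n}{k}.$$
   Context: $f(n)$ is the expected number of times the randomized counter $\textsc{RandCount}([n])$ sets a bit to $1$, which satisfies the stated recurrence. -}

module Defs where

open import Data.Nat using (ℕ; zero; suc; _!)
open import Data.Nat.Properties using (_!≢0)
open import Data.Nat.Combinatorics using (_C_)
open import Data.Product using (_×_)
open import Data.Integer using (+_)
open import Data.Rational using (ℚ; 0ℚ; 1ℚ; _+_; _*_; _/_)
open import Relation.Binary.PropositionalEquality using (_≡_)

sumBelow : ℕ → (ℕ → ℚ) → ℚ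
sumBelow zero    g = 0ℚ
sumBelow (suc n) g = sumBelow n g + g n

sumFrom1 : ℕ → (ℕ → ℚ) → ℚ
sumFrom1 zero    g = 0ℚ
sumFrom1 (suc n) g = sumFrom1 n g + g (suc n)

inv-suc : ℕ → ℚ
inv-suc n = + 1 / suc n

IsRecurrence : (ℕ → ℚ) → Set
IsRecurrence f =
  (f 0 ≡ 0ℚ) × ((m : ℕ) → f (suc m) ≡ f m + 1ℚ + inv-suc m * sumBelow (suc m) f)

closedForm : ℕ → ℚ
closedForm n = sumFrom1 n (λ k → _/_ (+ (n C k)) (k !) {{k !≢0}})

-- The closed form c n = Σ_{k=1}^{n} C(n,k)/k! satisfies the recurrence, and the recurrence
-- determines its solution, since f (n+1) is a function of f 0, …, f n.  For the recurrence,
-- Pascal's rule splits c (n+1) into c n + 1 + Σ_{k=1}^{n} C(n,k)/(k+1)!, the hockey-stick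
-- identity gives Σ_{i≤n} c i = Σ_{k=1}^{n} C(n+1,k+1)/k!, and the absorption identity
-- (k+1) C(n+1,k+1) = (n+1) C(n,k) turns the latter, divided by n+1, into the former.
module Submission where

open import Defs
open import Data.Nat as ℕ using (ℕ; zero; suc; _!; _<_; NonZero; ≢-nonZero⁻¹)
  renaming (_+_ to _+ℕ_; _*_ to _*ℕ_)
open import Data.Nat.Properties using (_!≢0; m*n≢0; n<1+n)
import Data.Nat.Properties as ℕ
open import Data.Nat.Combinatorics
  using (_C_; k>n⇒nCk≡0; nC1≡n; nCk+nC[k+1]≡[n+1]C[k+1])
open import Data.Integer using (+_) renaming (_+_ to _+ℤ_; _*_ to _*ℤ_)
open import Data.Integer.Properties using (pos-+; pos-*) renaming (*-distribʳ-+ to ℤ-*-distribʳ-+)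
open import Data.Rational using (ℚ; 0ℚ; 1ℚ; _+_; _*_; _/_; fromℚᵘ)
open import Data.Rational.Properties
  using (toℚᵘ-injective; toℚᵘ-fromℚᵘ; toℚᵘ-homo-+; toℚᵘ-homo-*; fromℚᵘ-cong;
         +-identityˡ; +-identityʳ; +-comm; *-zeroʳ; *-distribˡ-+)
  renaming (+-assoc to ℚ-+-assoc)
import Data.Rational.Unnormalised as ℚᵘ
import Data.Rational.Unnormalised.Properties as ℚᵘ
open import Data.Rational.Solver using (module +-*-Solver)
open import Data.Product using (_×_; _,_; proj₁; proj₂)
open import Data.Empty using (⊥-elim)
open import Relation.Binary.PropositionalEquality
  using (_≡_; refl; sym; trans; cong; cong₂; module ≡-Reasoning)

open +-*-Solver using (solve; _:+_; _:=_)

fromℚᵘ-homo-+ : ∀ p q → fromℚᵘ (p ℚᵘ.+ q) ≡ fromℚᵘ p + fromℚᵘ q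
fromℚᵘ-homo-+ p q = toℚᵘ-injective (ℚᵘ.≃-trans (toℚᵘ-fromℚᵘ (p ℚᵘ.+ q))
  (ℚᵘ.≃-sym (ℚᵘ.≃-trans (toℚᵘ-homo-+ (fromℚᵘ p) (fromℚᵘ q))
                        (ℚᵘ.+-cong (toℚᵘ-fromℚᵘ p) (toℚᵘ-fromℚᵘ q)))))

fromℚᵘ-homo-* : ∀ p q → fromℚᵘ (p ℚᵘ.* q) ≡ fromℚᵘ p * fromℚᵘ q
fromℚᵘ-homo-* p q = toℚᵘ-injective (ℚᵘ.≃-trans (toℚᵘ-fromℚᵘ (p ℚᵘ.* q))
  (ℚᵘ.≃-sym (ℚᵘ.≃-trans (toℚᵘ-homo-* (fromℚᵘ p) (fromℚᵘ q))
                        (ℚᵘ.*-cong (toℚᵘ-fromℚᵘ p) (toℚᵘ-fromℚᵘ q)))))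

-- On a successor denominator, + a / suc d is definitionally fromℚᵘ (mkℚᵘ (+ a) d);
-- each lemma below reduces to that case.

/-cross : ∀ a b m n .{{_ : NonZero m}} .{{_ : NonZero n}} →
          a *ℕ n ≡ b *ℕ m → + a / m ≡ + b / n
/-cross a b zero n {{m≢0}} _ = ⊥-elim (≢-nonZero⁻¹ 0 {{m≢0}} refl)
/-cross a b (suc m) zero {{_}} {{n≢0}} _ = ⊥-elim (≢-nonZero⁻¹ 0 {{n≢0}} refl)
/-cross a b (suc m) (suc n) eq = fromℚᵘ-cong {ℚᵘ.mkℚᵘ (+ a) m} {ℚᵘ.mkℚᵘ (+ b) n}
  (ℚᵘ.*≡* (trans (sym (pos-* a (suc n))) (trans (cong +_ eq) (pos-* b (suc m)))))

/-+-/ : ∀ a b d .{{_ : NonZero d}} → + a / d + + b / d ≡ + (a +ℕ b) / d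
/-+-/ a b zero {{d≢0}} = ⊥-elim (≢-nonZero⁻¹ 0 {{d≢0}} refl)
/-+-/ a b d@(suc _) = begin
  + a / d + + b / d
    ≡⟨ fromℚᵘ-homo-+ (+ a ℚᵘ./ d) (+ b ℚᵘ./ d) ⟨
  (+ a *ℤ + d +ℤ + b *ℤ + d) / (d *ℕ d)
    ≡⟨ cong (_/ (d *ℕ d)) (ℤ-*-distribʳ-+ (+ d) (+ a) (+ b)) ⟨
  ((+ a +ℤ + b) *ℤ + d) / (d *ℕ d)
    ≡⟨ fromℚᵘ-cong (ℚᵘ.*-cancelʳ-/ d {+ a +ℤ + b} {d}) ⟩
  (+ a +ℤ + b) / d
    ≡⟨ cong (_/ d) (pos-+ a b) ⟨
  + (a +ℕ b) / d
    ∎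
  where open ≡-Reasoning

/-*-/ : ∀ a b m n .{{_ : NonZero m}} .{{_ : NonZero n}} →
        (+ a / m) * (+ b / n) ≡ (+ (a *ℕ b) / (m *ℕ n)) {{m*n≢0 m n}}
/-*-/ a b zero n {{m≢0}} = ⊥-elim (≢-nonZero⁻¹ 0 {{m≢0}} refl)
/-*-/ a b (suc m) zero {{_}} {{n≢0}} = ⊥-elim (≢-nonZero⁻¹ 0 {{n≢0}} refl)
/-*-/ a b m@(suc _) n@(suc _) =
  trans (sym (fromℚᵘ-homo-* (+ a ℚᵘ./ m) (+ b ℚᵘ./ n)))
        (cong (_/ (m *ℕ n)) (sym (pos-* a b)))

sumFrom1-cong : ∀ n {g h : ℕ → ℚ} → (∀ k → g (suc k) ≡ h (suc k)) → sumFrom1 n g ≡ sumFrom1 n h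
sumFrom1-cong zero    eq = refl
sumFrom1-cong (suc n) eq = cong₂ _+_ (sumFrom1-cong n eq) (eq n)

sumFrom1-+ : ∀ n (g h : ℕ → ℚ) → sumFrom1 n (λ k → g k + h k) ≡ sumFrom1 n g + sumFrom1 n h
sumFrom1-+ zero    g h = refl
sumFrom1-+ (suc n) g h = trans (cong (_+ (g (suc n) + h (suc n))) (sumFrom1-+ n g h))
  (solve 4 (λ a b c d → (a :+ b) :+ (c :+ d) := (a :+ c) :+ (b :+ d)) refl
     (sumFrom1 n g) (sumFrom1 n h) (g (suc n)) (h (suc n)))

sumFrom1-*ˡ : ∀ n c (g : ℕ → ℚ) → sumFrom1 n (λ k → c * g k) ≡ c * sumFrom1 n g
sumFrom1-*ˡ zero    c g = sym (*-zeroʳ c)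
sumFrom1-*ˡ (suc n) c g = trans (cong (_+ c * g (suc n)) (sumFrom1-*ˡ n c g))
  (sym (*-distribˡ-+ c (sumFrom1 n g) (g (suc n))))

sumFrom1-suc-head : ∀ n (g : ℕ → ℚ) → sumFrom1 (suc n) g ≡ g 1 + sumFrom1 n (λ k → g (suc k))
sumFrom1-suc-head zero    g = +-comm 0ℚ (g 1)
sumFrom1-suc-head (suc n) g =
  trans (cong (_+ g (suc (suc n))) (sumFrom1-suc-head n g)) (ℚ-+-assoc (g 1) _ _)

sumFrom1-suc-last-0 : ∀ n (g : ℕ → ℚ) → g (suc n) ≡ 0ℚ → sumFrom1 (suc n) g ≡ sumFrom1 n g
sumFrom1-suc-last-0 n g g[1+n]≡0 =
  trans (cong (λ x → sumFrom1 n g + x) g[1+n]≡0) (+-identityʳ (sumFrom1 n g))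

[k+1]*[n+1]C[k+1]≡[n+1]*nCk : ∀ n k → suc k *ℕ (suc n C suc k) ≡ suc n *ℕ (n C k)
[k+1]*[n+1]C[k+1]≡[n+1]*nCk zero zero = refl
[k+1]*[n+1]C[k+1]≡[n+1]*nCk zero (suc k) = ℕ.*-zeroʳ (suc (suc k))
[k+1]*[n+1]C[k+1]≡[n+1]*nCk (suc n) zero =
  trans (ℕ.*-identityˡ _) (trans (nC1≡n (suc (suc n))) (sym (ℕ.*-identityʳ (suc (suc n)))))
[k+1]*[n+1]C[k+1]≡[n+1]*nCk (suc n) (suc k) = begin
  suc (suc k) *ℕ (suc (suc n) C suc (suc k))
    ≡⟨ cong (suc (suc k) *ℕ_) (nCk+nC[k+1]≡[n+1]C[k+1] (suc n) (suc k)) ⟨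
  suc (suc k) *ℕ (suc n C suc k +ℕ suc n C suc (suc k))
    ≡⟨ ℕ.*-distribˡ-+ (suc (suc k)) (suc n C suc k) _ ⟩
  suc n C suc k +ℕ suc k *ℕ (suc n C suc k) +ℕ suc (suc k) *ℕ (suc n C suc (suc k))
    ≡⟨ cong₂ (λ x y → suc n C suc k +ℕ x +ℕ y)
             ([k+1]*[n+1]C[k+1]≡[n+1]*nCk n k) ([k+1]*[n+1]C[k+1]≡[n+1]*nCk n (suc k)) ⟩
  suc n C suc k +ℕ suc n *ℕ (n C k) +ℕ suc n *ℕ (n C suc k)
    ≡⟨ ℕ.+-assoc (suc n C suc k) _ _ ⟩
  suc n C suc k +ℕ (suc n *ℕ (n C k) +ℕ suc n *ℕ (n C suc k))
    ≡⟨ cong (suc n C suc k +ℕ_) (ℕ.*-distribˡ-+ (suc n) (n C k) _) ⟨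
  suc n C suc k +ℕ suc n *ℕ (n C k +ℕ n C suc k)
    ≡⟨ cong (λ x → suc n C suc k +ℕ suc n *ℕ x) (nCk+nC[k+1]≡[n+1]C[k+1] n k) ⟩
  suc (suc n) *ℕ (suc n C suc k)
    ∎
  where open ≡-Reasoning

binom/fact : ℕ → ℕ → ℕ → ℚ
binom/fact n k j = (+ (n C k) / j !) {{j !≢0}}

binom/fact-pascal : ∀ n k j →
  binom/fact n k j + binom/fact n (suc k) j ≡ binom/fact (suc n) (suc k) j
binom/fact-pascal n k j = trans (/-+-/ (n C k) (n C suc k) (j !) {{j !≢0}})
  (cong (λ a → (+ a / j !) {{j !≢0}}) (nCk+nC[k+1]≡[n+1]C[k+1] n k))

binom/fact-vanish : ∀ {n k} j → n < k → binom/fact n k j ≡ 0ℚ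
binom/fact-vanish {n} {k} j n<k = begin
  binom/fact n k j       ≡⟨ cong (λ a → (+ a / j !) {{j !≢0}}) (k>n⇒nCk≡0 n<k) ⟩
  (+ 0 / j !) {{j !≢0}}  ≡⟨ /-cross 0 0 (j !) 1 {{j !≢0}} refl ⟩
  0ℚ                     ∎
  where open ≡-Reasoning

inv-suc-*-binom/fact : ∀ n k → inv-suc n * binom/fact (suc n) (suc k) k ≡ binom/fact n k (suc k)
inv-suc-*-binom/fact n k =
  trans (/-*-/ 1 (suc n C suc k) (suc n) (k !) {{_}} {{k !≢0}})
        (/-cross (1 *ℕ (suc n C suc k)) (n C k) (suc n *ℕ k !) (suc k !)
                 {{m*n≢0 (suc n) (k !) {{_}} {{k !≢0}}}} {{suc k !≢0}} cross)
  where
  open ≡-Reasoning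
  cross : (1 *ℕ (suc n C suc k)) *ℕ (suc k *ℕ k !) ≡ (n C k) *ℕ (suc n *ℕ k !)
  cross = begin
    (1 *ℕ (suc n C suc k)) *ℕ (suc k *ℕ k !)
      ≡⟨ cong (_*ℕ (suc k *ℕ k !)) (ℕ.*-identityˡ (suc n C suc k)) ⟩
    (suc n C suc k) *ℕ (suc k *ℕ k !)
      ≡⟨ ℕ.*-assoc (suc n C suc k) (suc k) (k !) ⟨
    (suc n C suc k) *ℕ suc k *ℕ k !
      ≡⟨ cong (_*ℕ k !) (ℕ.*-comm (suc n C suc k) (suc k)) ⟩
    suc k *ℕ (suc n C suc k) *ℕ k !
      ≡⟨ cong (_*ℕ k !) ([k+1]*[n+1]C[k+1]≡[n+1]*nCk n k) ⟩
    suc n *ℕ (n C k) *ℕ k !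
      ≡⟨ cong (_*ℕ k !) (ℕ.*-comm (suc n) (n C k)) ⟩
    (n C k) *ℕ suc n *ℕ k !
      ≡⟨ ℕ.*-assoc (n C k) (suc n) (k !) ⟩
    (n C k) *ℕ (suc n *ℕ k !)
      ∎

shiftedSum : ℕ → ℚ
shiftedSum n = sumFrom1 n (λ k → binom/fact n k (suc k))

closedForm-suc : ∀ n → closedForm (suc n) ≡ closedForm n + 1ℚ + shiftedSum n
closedForm-suc n = begin
  closedForm (suc n)
    ≡⟨ sumFrom1-cong (suc n) (λ k → sym (binom/fact-pascal n k (suc k))) ⟩
  sumFrom1 (suc n) (λ k → binom/fact n (ℕ.pred k) k + binom/fact n k k)
    ≡⟨ sumFrom1-+ (suc n) (λ k → binom/fact n (ℕ.pred k) k) (λ k → binom/fact n k k) ⟩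
  sumFrom1 (suc n) (λ k → binom/fact n (ℕ.pred k) k) + sumFrom1 (suc n) (λ k → binom/fact n k k)
    ≡⟨ cong₂ _+_ (sumFrom1-suc-head n (λ k → binom/fact n (ℕ.pred k) k))
                 (sumFrom1-suc-last-0 n (λ k → binom/fact n k k)
                                      (binom/fact-vanish (suc n) (n<1+n n))) ⟩
  (1ℚ + shiftedSum n) + closedForm n
    ≡⟨ solve 3 (λ a b c → (a :+ b) :+ c := c :+ a :+ b) refl 1ℚ (shiftedSum n) (closedForm n) ⟩
  closedForm n + 1ℚ + shiftedSum n
    ∎
  where open ≡-Reasoning

sumBelow-closedForm : ∀ n →
  sumBelow (suc n) closedForm ≡ sumFrom1 n (λ k → binom/fact (suc n) (suc k) k)
sumBelow-closedForm zero    = +-identityˡ 0ℚ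
sumBelow-closedForm (suc n) = begin
  sumBelow (suc n) closedForm + closedForm (suc n)
    ≡⟨ cong (_+ closedForm (suc n)) (sumBelow-closedForm n) ⟩
  sumFrom1 n (λ k → binom/fact (suc n) (suc k) k) + closedForm (suc n)
    ≡⟨ cong (_+ closedForm (suc n))
            (sumFrom1-suc-last-0 n _ (binom/fact-vanish (suc n) (n<1+n (suc n)))) ⟨
  sumFrom1 (suc n) (λ k → binom/fact (suc n) (suc k) k) + closedForm (suc n)
    ≡⟨ +-comm _ (closedForm (suc n)) ⟩
  closedForm (suc n) + sumFrom1 (suc n) (λ k → binom/fact (suc n) (suc k) k)
    ≡⟨ sumFrom1-+ (suc n) (λ k → binom/fact (suc n) k k) (λ k → binom/fact (suc n) (suc k) k) ⟨
  sumFrom1 (suc n) (λ k → binom/fact (suc n) k k + binom/fact (suc n) (suc k) k)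
    ≡⟨ sumFrom1-cong (suc n) (λ k → binom/fact-pascal (suc n) (suc k) (suc k)) ⟩
  sumFrom1 (suc n) (λ k → binom/fact (suc (suc n)) (suc k) k)
    ∎
  where open ≡-Reasoning

inv-suc-*-sumBelow-closedForm : ∀ n → inv-suc n * sumBelow (suc n) closedForm ≡ shiftedSum n
inv-suc-*-sumBelow-closedForm n = begin
  inv-suc n * sumBelow (suc n) closedForm
    ≡⟨ cong (inv-suc n *_) (sumBelow-closedForm n) ⟩
  inv-suc n * sumFrom1 n (λ k → binom/fact (suc n) (suc k) k)
    ≡⟨ sumFrom1-*ˡ n (inv-suc n) (λ k → binom/fact (suc n) (suc k) k) ⟨
  sumFrom1 n (λ k → inv-suc n * binom/fact (suc n) (suc k) k)
    ≡⟨ sumFrom1-cong n (λ k → inv-suc-*-binom/fact n (suc k)) ⟩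
  shiftedSum n
    ∎
  where open ≡-Reasoning

closedForm-isRecurrence : IsRecurrence closedForm
closedForm-isRecurrence = refl , λ n →
  trans (closedForm-suc n)
        (cong (λ x → closedForm n + 1ℚ + x) (sym (inv-suc-*-sumBelow-closedForm n)))

recurrence-unique : ∀ {f g} → IsRecurrence f → IsRecurrence g → ∀ n → f n ≡ g n
recurrence-unique {f} {g} (f0 , f-suc) (g0 , g-suc) n = proj₁ (agree n)
  where
  agree : ∀ n → f n ≡ g n × sumBelow (suc n) f ≡ sumBelow (suc n) g
  agree zero    = trans f0 (sym g0) , cong (λ x → 0ℚ + x) (trans f0 (sym g0))
  agree (suc n) = f≡g , cong₂ _+_ sums≡ f≡g
    where
    fn≡gn : f n ≡ g n
    fn≡gn = proj₁ (agree n)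
    sums≡ : sumBelow (suc n) f ≡ sumBelow (suc n) g
    sums≡ = proj₂ (agree n)
    f≡g : f (suc n) ≡ g (suc n)
    f≡g = trans (f-suc n)
      (trans (cong₂ (λ x s → x + 1ℚ + inv-suc n * s) fn≡gn sums≡) (sym (g-suc n)))

mainTheorem4 : (f : ℕ → ℚ) → IsRecurrence f → (n : ℕ) → f n ≡ closedForm n
mainTheorem4 f rec = recurrence-unique rec closedForm-isRecurrence
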